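{- Let $D=(V_1,V_2;A)$ be a 2-arc-strong split digraph such that $V_1$ is an independent set, $V_2$ induces a semicomplete digraph, and the partition is maximal, i.e. no vertex $x\in V_1$ is adjacent to every vertex of $V_2$. If $|V_2|=3$, then $D$ has a strong arc decomposition.
   Context: A digraph is semicomplete if every two distinct vertices are joined by at least one arc. A digraph is strong if every vertex can reach every other by a directed path, and 2-arc-strong if it remains strong after deleting any single arc. A strong arc decomposition of $D$ is a partition of $A$ into disjoint $A_1,A_2$ such that both spanning subdigraphs $(V(D),A_1)$ and $(V(D),A_2)$ are strong. -}

module Defs where

open import Data.Nat using (ℕ)
open import Data.Fin using (Fin)
open import Data.Fin.Subset using (Subset; _∈_; _∉_; ∣_∣)
open import Data.Bool using (Bool; true; false)
open import Data.Product using (_×_; ∃)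
open import Data.Sum using (_⊎_)
open import Relation.Nullary using (¬_)
open import Relation.Binary.PropositionalEquality using (_≡_)
open import Relation.Binary.Construct.Closure.ReflexiveTransitive using (Star)

Digraph : ℕ → Set
Digraph n = Fin n → Fin n → Bool

Loopless : {n : ℕ} → Digraph n → Set
Loopless {n} A = (u : Fin n) → A u u ≡ false

Arc : {n : ℕ} → Digraph n → Fin n → Fin n → Set
Arc A u v = A u v ≡ true

StrongRel : {n : ℕ} → (Fin n → Fin n → Set) → Set
StrongRel {n} R = (u v : Fin n) → Star R u v

Strong : {n : ℕ} → Digraph n → Set
Strong A = StrongRel (Arc A)

ArcMinus : {n : ℕ} → Digraph n → Fin n → Fin n → Fin n → Fin n → Set
ArcMinus A a b u v = Arc A u v × ¬ (u ≡ a × v ≡ b)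

TwoArcStrong : {n : ℕ} → Digraph n → Set
TwoArcStrong {n} A =
  Strong A × ((a b : Fin n) → Arc A a b → StrongRel (ArcMinus A a b))

Adjacent : {n : ℕ} → Digraph n → Fin n → Fin n → Set
Adjacent A u v = Arc A u v ⊎ Arc A v u

-- Strong arc decomposition: a 2-colouring of the arcs (colour true = A₁,
-- colour false = A₂) such that both spanning subdigraphs are strong.
ArcClass : {n : ℕ} → Digraph n → (Fin n → Fin n → Bool) → Bool → Fin n → Fin n → Set
ArcClass A col c u v = Arc A u v × col u v ≡ c

HasStrongArcDecomposition : {n : ℕ} → Digraph n → Set
HasStrongArcDecomposition {n} A =
  ∃ λ (col : Fin n → Fin n → Bool) →
    StrongRel (ArcClass A col true) × StrongRel (ArcClass A col false)

-- Split digraph with partition (V₁, V₂), V₂ given as a subset, V₁ its complement: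
-- V₁ independent, V₂ semicomplete.
IndependentV1 : {n : ℕ} → Digraph n → Subset n → Set
IndependentV1 {n} A V₂ = (u v : Fin n) → u ∉ V₂ → v ∉ V₂ → ¬ Adjacent A u v

SemicompleteV2 : {n : ℕ} → Digraph n → Subset n → Set
SemicompleteV2 {n} A V₂ = (u v : Fin n) → u ∈ V₂ → v ∈ V₂ → ¬ (u ≡ v) → Adjacent A u v

MaximalPartition : {n : ℕ} → Digraph n → Subset n → Set
MaximalPartition {n} A V₂ =
  (x : Fin n) → x ∉ V₂ → ¬ ((y : Fin n) → y ∈ V₂ → Adjacent A x y)

-- Every vertex x of V₁ has all its neighbours in V₂ = {a, b, c}, in- and out-degree at least 2,
-- and by maximality a non-neighbour in V₂; hence x forms 2-cycles with two vertices of V₂ and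
-- misses the third.  If every pair of V₂ is a 2-cycle or its third vertex is missed by some
-- x ∈ V₁, colour the cycle a → b → c → a (with such vertices x as detours) and its reverse
-- differently.  Otherwise some pair is joined by a single arc a → b and every x ∈ V₁ misses a or
-- b; an in-neighbour x₁ of a and an out-neighbour y₁ of b in V₁ give the cycle
-- a → b → y₁ → c → x₁ → a, and 2-arc-strength supplies routes b ⇝ c and c ⇝ a avoiding y₁ and x₁
-- for the other colour.
module Submission where

open import Defs
open import Data.Nat using (ℕ; zero; suc)
open import Data.Fin using (Fin; zero; suc; _≟_)
open import Data.Fin.Patterns using (0F; 1F; 2F)
open import Data.Fin.Properties using (any?; all?; suc-injective)
open import Data.Fin.Subset using (Subset; _∈_; _∉_; ∣_∣)
open import Data.Fin.Subset.Properties using (_∈?_)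
open import Data.Vec using ([]; _∷_; here; there)
open import Data.Bool using (Bool; true; false; _∨_; if_then_else_)
open import Data.Bool.Properties using (¬-not; ∨-zeroʳ) renaming (_≟_ to _≟ᵇ_)
open import Data.Product using (_×_; _,_; ∃; ∃₂; proj₁; proj₂)
open import Data.Sum using (_⊎_; inj₁; inj₂; [_,_]′; map₁)
open import Data.Empty using (⊥-elim)
open import Function using (flip; id; _∘_; case_of_)
open import Function.Definitions using (Injective)
open import Relation.Nullary using (¬_; Dec; yes; no; does; ¬?)
open import Relation.Nullary.Decidable using (_×-dec_; _⊎-dec_; _→-dec_; from-yes; dec-true; dec-false)
open import Relation.Binary.PropositionalEquality using (_≡_; _≢_; refl; sym; trans; cong; cong₂; subst)
open import Relation.Binary.Construct.Closure.ReflexiveTransitive using (Star; ε; _◅_; _◅◅_; reverse)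

first-step : ∀ {a r} {I : Set a} {R : I → I → Set r} {x y : I} → Star R x y → x ≢ y → ∃ (R x)
first-step ε         x≢y = ⊥-elim (x≢y refl)
first-step (r ◅ _)   _   = _ , r

record Enumeration {n : ℕ} (p : Subset n) (k : ℕ) : Set where
  field
    element            : Fin k → Fin n
    element-injective  : Injective _≡_ _≡_ element
    element-∈          : ∀ i → element i ∈ p
    element-surjective : ∀ {v} → v ∈ p → ∃ λ i → element i ≡ v

enumerate : ∀ {n} (p : Subset n) → Enumeration p ∣ p ∣
enumerate [] = record
  { element = λ () ; element-injective = λ { {()} } ; element-∈ = λ () ; element-surjective = λ () }
enumerate (true ∷ p) = record
  { element = element′ ; element-injective = injective ; element-∈ = element′-∈ ; element-surjective = surjective }
  where
  open Enumeration (enumerate p)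
  element′ : Fin (suc ∣ p ∣) → Fin _
  element′ zero    = zero
  element′ (suc i) = suc (element i)
  injective : Injective _≡_ _≡_ element′
  injective {zero}  {zero}  _  = refl
  injective {suc i} {suc j} eq = cong suc (element-injective (suc-injective eq))
  element′-∈ : ∀ i → element′ i ∈ (true ∷ p)
  element′-∈ zero    = here
  element′-∈ (suc i) = there (element-∈ i)
  surjective : ∀ {v} → v ∈ (true ∷ p) → ∃ λ i → element′ i ≡ v
  surjective here      = zero , refl
  surjective (there v∈) with i , refl ← element-surjective v∈ = suc i , refl
enumerate (false ∷ p) = record
  { element = suc ∘ element ; element-injective = element-injective ∘ suc-injective
  ; element-∈ = there ∘ element-∈ ; element-surjective = surjective }
  where
  open Enumeration (enumerate p)
  surjective : ∀ {v} → v ∈ (false ∷ p) → ∃ λ i → suc (element i) ≡ v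
  surjective (there v∈) with i , refl ← element-surjective v∈ = i , refl

reindex : ∀ {n k} {p : Subset n} → Enumeration p k → (σ : Fin k → Fin k) →
  Injective _≡_ _≡_ σ → (∀ j → ∃ λ i → σ i ≡ j) → Enumeration p k
reindex {p = p} e σ σ-injective σ-surjective = record
  { element = element ∘ σ
  ; element-injective = σ-injective ∘ element-injective
  ; element-∈ = element-∈ ∘ σ
  ; element-surjective = surjective }
  where
  open Enumeration e
  surjective : ∀ {v} → v ∈ p → ∃ λ i → element (σ i) ≡ v
  surjective v∈ with j , refl ← element-surjective v∈ with i , refl ← σ-surjective j = i , refl

fin3-covered : {p q r : Fin 3} → p ≢ q → q ≢ r → p ≢ r → ∀ i → i ≡ p ⊎ i ≡ q ⊎ i ≡ r
fin3-covered {p} {q} {r} = from-yes covered? p q r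
  where
  covered? : Dec (∀ (p q r : Fin 3) → p ≢ q → q ≢ r → p ≢ r → ∀ i → i ≡ p ⊎ i ≡ q ⊎ i ≡ r)
  covered? = all? λ p → all? λ q → all? λ r → ¬? (p ≟ q) →-dec ¬? (q ≟ r) →-dec ¬? (p ≟ r) →-dec
             all? λ i → (i ≟ p) ⊎-dec (i ≟ q) ⊎-dec (i ≟ r)

next : Fin 3 → Fin 3
next 0F = 1F
next 1F = 2F
next 2F = 0F

next-≢ : ∀ i → next i ≢ i
next-≢ 0F ()
next-≢ 1F ()
next-≢ 2F ()

next²-≢ : ∀ i → next (next i) ≢ i
next²-≢ 0F ()
next²-≢ 1F ()
next²-≢ 2F ()

next-≢-next² : ∀ i → next i ≢ next (next i)
next-≢-next² i = next-≢ (next i) ∘ sym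

≟-diag : ∀ {k} (i : Fin k) → does (i ≟ i) ≡ true
≟-diag i = dec-true (i ≟ i) refl

triple : Fin 3 → Fin 3 → Fin 3 → Fin 3 → Fin 3
triple p q r 0F = p
triple p q r 1F = q
triple p q r 2F = r

module _ {p q r : Fin 3} (p≢q : p ≢ q) (q≢r : q ≢ r) (p≢r : p ≢ r) where

  triple-injective : Injective _≡_ _≡_ (triple p q r)
  triple-injective {0F} {0F} _  = refl
  triple-injective {0F} {1F} eq = ⊥-elim (p≢q eq)
  triple-injective {0F} {2F} eq = ⊥-elim (p≢r eq)
  triple-injective {1F} {0F} eq = ⊥-elim (p≢q (sym eq))
  triple-injective {1F} {1F} _  = refl
  triple-injective {1F} {2F} eq = ⊥-elim (q≢r eq)
  triple-injective {2F} {0F} eq = ⊥-elim (p≢r (sym eq))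
  triple-injective {2F} {1F} eq = ⊥-elim (q≢r (sym eq))
  triple-injective {2F} {2F} _  = refl

  triple-surjective : ∀ j → ∃ λ i → triple p q r i ≡ j
  triple-surjective j with fin3-covered p≢q q≢r p≢r j
  ... | inj₁ refl        = 0F , refl
  ... | inj₂ (inj₁ refl) = 1F , refl
  ... | inj₂ (inj₂ refl) = 2F , refl

  cycle-connects : ∀ {a ℓ} {X : Set a} {R : X → X → Set ℓ} (f : Fin 3 → X) →
    Star R (f p) (f q) → Star R (f q) (f r) → Star R (f r) (f p) → ∀ i j → Star R (f i) (f j)
  cycle-connects {R = R} f pq qr rp i j = to-p i ◅◅ from-p j
    where
    to-p : ∀ i → Star R (f i) (f p)
    to-p i with fin3-covered p≢q q≢r p≢r i
    ... | inj₁ refl        = ε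
    ... | inj₂ (inj₁ refl) = qr ◅◅ rp
    ... | inj₂ (inj₂ refl) = rp
    from-p : ∀ j → Star R (f p) (f j)
    from-p j with fin3-covered p≢q q≢r p≢r j
    ... | inj₁ refl        = ε
    ... | inj₂ (inj₁ refl) = pq
    ... | inj₂ (inj₂ refl) = pq ◅◅ qr

true≢false : true ≢ false
true≢false ()

module _ {n : ℕ} {A : Digraph n} where

  loopless-≢ : Loopless A → ∀ {u v} → Arc A u v → u ≢ v
  loopless-≢ loopless u→u refl = true≢false (trans (sym u→u) (loopless _))

  converse-twoArcStrong : TwoArcStrong A → TwoArcStrong (flip A)
  converse-twoArcStrong (strong , robust) =
    (λ u v → reverse id (strong v u)) ,
    (λ a b ba u v → reverse (λ (arc , ≢ab) → arc , λ (≡a , ≡b) → ≢ab (≡b , ≡a)) (robust b a ba v u))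

  out-neighbour-avoiding : TwoArcStrong A → ∀ {t v₀} → t ≢ v₀ → ∃ λ v → Arc A t v × v ≢ v₀
  out-neighbour-avoiding (strong , robust) {t} {v₀} t≢v₀ with A t v₀ in t→v₀
  ... | true with v , (t→v , ≢) ← first-step (robust t v₀ t→v₀ t v₀) t≢v₀ =
    v , t→v , λ v≡v₀ → ≢ (refl , v≡v₀)
  ... | false with v , t→v ← first-step (strong t v₀) t≢v₀ =
    v , t→v , λ { refl → true≢false (trans (sym t→v) t→v₀) }

  two-out-neighbours : Loopless A → TwoArcStrong A → ∀ {t u} → t ≢ u →
    ∃₂ λ v w → v ≢ w × Arc A t v × Arc A t w
  two-out-neighbours loopless two-arc-strong t≢u
    with v , t→v , _ ← out-neighbour-avoiding two-arc-strong t≢u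
    with w , t→w , w≢v ← out-neighbour-avoiding two-arc-strong (loopless-≢ loopless t→v)
    = v , w , (λ v≡w → w≢v (sym v≡w)) , t→v , t→w

in-neighbour-avoiding : ∀ {n} {A : Digraph n} → TwoArcStrong A → ∀ {t u₀} → t ≢ u₀ →
  ∃ λ u → Arc A u t × u ≢ u₀
in-neighbour-avoiding {A = A} = out-neighbour-avoiding {A = flip A} ∘ converse-twoArcStrong

two-in-neighbours : ∀ {n} {A : Digraph n} → Loopless A → TwoArcStrong A → ∀ {t u} → t ≢ u →
  ∃₂ λ v w → v ≢ w × Arc A v t × Arc A w t
two-in-neighbours {A = A} loopless = two-out-neighbours {A = flip A} loopless ∘ converse-twoArcStrong

strong-via-core : ∀ {n ℓ} {R : Fin n → Fin n → Set ℓ} (C : Subset n) →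
  (∀ {u v} → u ∈ C → v ∈ C → Star R u v) →
  (∀ {x} → x ∉ C → ∃ λ v → v ∈ C × R x v) →
  (∀ {x} → x ∉ C → ∃ λ u → u ∈ C × R u x) →
  ∀ u v → Star R u v
strong-via-core {R = R} C core exit entry u v = join (into u) (out-of v)
  where
  into : ∀ u → ∃ λ u′ → u′ ∈ C × Star R u u′
  into u with u ∈? C
  ... | yes u∈ = u , u∈ , ε
  ... | no u∉ with u′ , u′∈ , r ← exit u∉ = u′ , u′∈ , r ◅ ε
  out-of : ∀ v → ∃ λ v′ → v′ ∈ C × Star R v′ v
  out-of v with v ∈? C
  ... | yes v∈ = v , v∈ , ε
  ... | no v∉ with v′ , v′∈ , r ← entry v∉ = v′ , v′∈ , r ◅ ε
  join : (∃ λ u′ → u′ ∈ C × Star R u u′) → (∃ λ v′ → v′ ∈ C × Star R v′ v) → Star R u v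
  join (u′ , u′∈ , u⇝u′) (v′ , v′∈ , v′⇝v) = u⇝u′ ◅◅ core u′∈ v′∈ ◅◅ v′⇝v

all-or : ∀ {k a b} {P : Fin k → Set a} {Q : Set b} → (∀ i → P i ⊎ Q) → (∀ i → P i) ⊎ Q
all-or {zero}  _ = inj₁ λ ()
all-or {suc k} f with f zero | all-or (f ∘ suc)
... | inj₂ q  | _       = inj₂ q
... | inj₁ _  | inj₂ q  = inj₂ q
... | inj₁ p₀ | inj₁ ps = inj₁ λ { zero → p₀ ; (suc i) → ps i }

adjacentᵇ : ∀ {n} → Digraph n → Fin n → Fin n → Bool
adjacentᵇ A u v = A u v ∨ A v u

TwoCycle : ∀ {n} → Digraph n → Fin n → Fin n → Set
TwoCycle A u v = Arc A u v × Arc A v u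

module Adjacency {n : ℕ} (A : Digraph n) {u v : Fin n} where

  adjacentᵇ-complete : Adjacent A u v → adjacentᵇ A u v ≡ true
  adjacentᵇ-complete (inj₁ u→v) rewrite u→v = refl
  adjacentᵇ-complete (inj₂ v→u) rewrite v→u = ∨-zeroʳ (A u v)

  adjacentᵇ-sound : adjacentᵇ A u v ≡ true → Adjacent A u v
  adjacentᵇ-sound adj with A u v
  ... | true  = inj₁ refl
  ... | false = inj₂ adj

  nonadjacent⇒¬arc : adjacentᵇ A u v ≡ false → ¬ Arc A u v
  nonadjacent⇒¬arc nonadj u→v = true≢false (trans (sym (adjacentᵇ-complete (inj₁ u→v))) nonadj)

module SplitDigraph {n : ℕ} {A : Digraph n} {V₂ : Subset n}
  (loopless : Loopless A) (two-arc-strong : TwoArcStrong A)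
  (independent : IndependentV1 A V₂) (semicomplete : SemicompleteV2 A V₂)
  (maximal : MaximalPartition A V₂) where

  open Adjacency A

  neighbour-∈ : ∀ {x v} → x ∉ V₂ → Adjacent A x v → v ∈ V₂
  neighbour-∈ {x} {v} x∉ adj with v ∈? V₂
  ... | yes v∈ = v∈
  ... | no  v∉ = ⊥-elim (independent x v x∉ v∉ adj)

  module Decomposition (e : Enumeration V₂ 3) where
    open Enumeration e

    element-≢ : ∀ {i j} → i ≢ j → element i ≢ element j
    element-≢ i≢j = i≢j ∘ element-injective

    missed : Fin n → Fin 3
    missed x = if adjacentᵇ A x (element 0F) then (if adjacentᵇ A x (element 1F) then 2F else 1F) else 0F

    missed-nonadjacent : ∀ {x} → x ∉ V₂ → adjacentᵇ A x (element (missed x)) ≡ false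
    missed-nonadjacent {x} x∉
      with adjacentᵇ A x (element 0F) in adj₀ | adjacentᵇ A x (element 1F) in adj₁
         | adjacentᵇ A x (element 2F) in adj₂
    ... | false | _     | _     = adj₀
    ... | true  | false | _     = adj₁
    ... | true  | true  | false = adj₂
    ... | true  | true  | true  = ⊥-elim (maximal x x∉ adjacent-to-all)
      where
      adjacent-to-all : ∀ y → y ∈ V₂ → Adjacent A x y
      adjacent-to-all y y∈ with element-surjective y∈
      ... | 0F , refl = adjacentᵇ-sound adj₀
      ... | 1F , refl = adjacentᵇ-sound adj₁
      ... | 2F , refl = adjacentᵇ-sound adj₂

    adjacent-not-missed : ∀ {x i} → x ∉ V₂ → Adjacent A x (element i) → i ≢ missed x
    adjacent-not-missed x∉ adj refl =
      true≢false (trans (sym (adjacentᵇ-complete adj)) (missed-nonadjacent x∉))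

    two-neighbours-cover : ∀ {ℓ} (P : Fin n → Set ℓ) {x v w} → x ∉ V₂ → v ≢ w →
      Adjacent A x v → Adjacent A x w → P v → P w → ∀ i → i ≢ missed x → P (element i)
    two-neighbours-cover P x∉ v≢w adj-v adj-w Pv Pw i i≢m
      with iv , refl ← element-surjective (neighbour-∈ x∉ adj-v)
         | iw , refl ← element-surjective (neighbour-∈ x∉ adj-w)
      with fin3-covered (v≢w ∘ cong element) (adjacent-not-missed x∉ adj-w) (adjacent-not-missed x∉ adj-v) i
    ... | inj₁ refl        = Pv
    ... | inj₂ (inj₁ refl) = Pw
    ... | inj₂ (inj₂ refl) = ⊥-elim (i≢m refl)

    two-cycle-unless-missed : ∀ {x i} → x ∉ V₂ → i ≢ missed x → TwoCycle A x (element i)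
    two-cycle-unless-missed {x} {i} x∉ i≢m = out-arc , in-arc
      where
      x≢element : x ≢ element 0F
      x≢element refl = x∉ (element-∈ 0F)
      out-arc : Arc A x (element i)
      out-arc with v , w , v≢w , x→v , x→w ← two-out-neighbours loopless two-arc-strong x≢element =
        two-neighbours-cover (Arc A x) x∉ v≢w (inj₁ x→v) (inj₁ x→w) x→v x→w i i≢m
      in-arc : Arc A (element i) x
      in-arc with v , w , v≢w , v→x , w→x ← two-in-neighbours loopless two-arc-strong x≢element =
        two-neighbours-cover (λ u → Arc A u x) x∉ v≢w (inj₂ v→x) (inj₂ w→x) v→x w→x i i≢m

    nonadjacent⇒missed : ∀ {x i} → x ∉ V₂ → adjacentᵇ A x (element i) ≡ false → missed x ≡ i
    nonadjacent⇒missed {x} {i} x∉ nonadj with missed x ≟ i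
    ... | yes m≡i = m≡i
    ... | no  m≢i = ⊥-elim (nonadjacent⇒¬arc nonadj (proj₁ (two-cycle-unless-missed x∉ (m≢i ∘ sym))))

    data Role : Set where
      core  : Fin 3 → Role
      outer : Fin 3 → Bool → Role

    Exit Entry : (Role → Role → Bool) → Bool → Fin 3 → Bool → Set
    Exit  table k m d = ∃ λ j → j ≢ m × table (outer m d) (core j) ≡ k
    Entry table k m d = ∃ λ i → i ≢ m × table (core i) (outer m d) ≡ k

    module Colouring (designated : Fin n → Bool) (table : Role → Role → Bool) where

      role : Fin n → Role
      role u with u ∈? V₂
      ... | yes u∈ = core (proj₁ (element-surjective u∈))
      ... | no  _  = outer (missed u) (designated u)

      colour : Fin n → Fin n → Bool
      colour u v = table (role u) (role v)

      Class : Bool → Fin n → Fin n → Set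
      Class = ArcClass A colour

      role-core : ∀ i → role (element i) ≡ core i
      role-core i with element i ∈? V₂
      ... | yes i∈ = cong core (element-injective (proj₂ (element-surjective i∈)))
      ... | no  i∉ = ⊥-elim (i∉ (element-∈ i))

      role-outer : ∀ {x m d} → x ∉ V₂ → missed x ≡ m → designated x ≡ d → role x ≡ outer m d
      role-outer {x} x∉ refl refl with x ∈? V₂
      ... | yes x∈ = ⊥-elim (x∉ x∈)
      ... | no  _  = refl

      role-outer⁻¹ : ∀ {x m d} → role x ≡ outer m d → x ∉ V₂ × missed x ≡ m
      role-outer⁻¹ {x} r with x ∈? V₂
      role-outer⁻¹ () | yes _
      role-outer⁻¹ refl | no x∉ = x∉ , refl

      core-arc : ∀ {i j k} → Arc A (element i) (element j) → table (core i) (core j) ≡ k →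
        Star (Class k) (element i) (element j)
      core-arc {i} {j} arc coloured = (arc , trans (cong₂ table (role-core i) (role-core j)) coloured) ◅ ε

      detour : ∀ {x i j m d k} → role x ≡ outer m d → i ≢ m → j ≢ m →
        table (core i) (outer m d) ≡ k → table (outer m d) (core j) ≡ k →
        Star (Class k) (element i) (element j)
      detour {x} {i} {j} r i≢m j≢m into out-of with x∉ , refl ← role-outer⁻¹ r =
        (proj₂ (two-cycle-unless-missed x∉ i≢m) , trans (cong₂ table (role-core i) r) into) ◅
        (proj₁ (two-cycle-unless-missed x∉ j≢m) , trans (cong₂ table r (role-core j)) out-of) ◅ ε

      class-strong : ∀ {k} → (∀ i j → Star (Class k) (element i) (element j)) →
        (∀ {x} → x ∉ V₂ → Exit table k (missed x) (designated x)) →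
        (∀ {x} → x ∉ V₂ → Entry table k (missed x) (designated x)) → StrongRel (Class k)
      class-strong {k} core-strong exit entry = strong-via-core V₂ core-strong′ exit′ entry′
        where
        core-strong′ : ∀ {u v} → u ∈ V₂ → v ∈ V₂ → Star (Class k) u v
        core-strong′ u∈ v∈ with i , refl ← element-surjective u∈ | j , refl ← element-surjective v∈ =
          core-strong i j
        exit′ : ∀ {x} → x ∉ V₂ → ∃ λ v → v ∈ V₂ × Class k x v
        exit′ x∉ with j , j≢m , coloured ← exit x∉ =
          element j , element-∈ j , proj₁ (two-cycle-unless-missed x∉ j≢m) ,
          trans (cong₂ table (role-outer x∉ refl refl) (role-core j)) coloured
        entry′ : ∀ {x} → x ∉ V₂ → ∃ λ u → u ∈ V₂ × Class k u x
        entry′ x∉ with i , i≢m , coloured ← entry x∉ =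
          element i , element-∈ i , proj₂ (two-cycle-unless-missed x∉ i≢m) ,
          trans (cong₂ table (role-core i) (role-outer x∉ refl refl)) coloured

    -- Colour true is the cycle 0 → 1 → 2 → 0, each outer vertex missing m subdividing the arc
    -- next m → next² m; colour false contains the reverse cycle.
    cyclic : Role → Role → Bool
    cyclic (core i)    (core j)    = does (j ≟ next i)
    cyclic (core i)    (outer m _) = does (i ≟ next m)
    cyclic (outer m _) (core j)    = does (j ≟ next (next m))
    cyclic (outer _ _) (outer _ _) = false

    cyclic-exit : ∀ k m d → Exit cyclic k m d
    cyclic-exit true  m _ = next (next m) , next²-≢ m , ≟-diag (next (next m))
    cyclic-exit false m _ = next m , next-≢ m , dec-false (_ ≟ _) (next-≢-next² m)

    cyclic-entry : ∀ k m d → Entry cyclic k m d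
    cyclic-entry true  m _ = next m , next-≢ m , ≟-diag (next m)
    cyclic-entry false m _ = next (next m) , next²-≢ m , dec-false (_ ≟ _) (next-≢ (next m))

    Gap : Fin 3 → Set
    Gap m = TwoCycle A (element (next m)) (element (next (next m)))
          ⊎ ∃ λ x → x ∉ V₂ × adjacentᵇ A x (element m) ≡ false

    cyclic-decomposition : (∀ m → Gap m) → HasStrongArcDecomposition A
    cyclic-decomposition gap =
      colour ,
      class-strong (cycle-connects {0F} {1F} {2F} (λ ()) (λ ()) (λ ()) element
                      (proj₁ (side 2F)) (proj₁ (side 0F)) (proj₁ (side 1F)))
                   (λ {x} _ → cyclic-exit true (missed x) false) (λ {x} _ → cyclic-entry true (missed x) false) ,
      class-strong (cycle-connects {0F} {2F} {1F} (λ ()) (λ ()) (λ ()) element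
                      (proj₂ (side 1F)) (proj₂ (side 0F)) (proj₂ (side 2F)))
                   (λ {x} _ → cyclic-exit false (missed x) false) (λ {x} _ → cyclic-entry false (missed x) false)
      where
      open Colouring (λ _ → false) cyclic
      side : ∀ m → Star (Class true) (element (next m)) (element (next (next m)))
                 × Star (Class false) (element (next (next m))) (element (next m))
      side m with gap m
      ... | inj₁ (p→q , q→p) =
        core-arc p→q (≟-diag (next (next m))) , core-arc q→p (dec-false (_ ≟ _) (next²-≢ (next m) ∘ sym))
      ... | inj₂ (x , x∉ , nonadjacent) =
        detour r (next-≢ m) (next²-≢ m) (≟-diag (next m)) (≟-diag (next (next m))) ,
        detour r (next²-≢ m) (next-≢ m) (dec-false (_ ≟ _) (next-≢ (next m))) (dec-false (_ ≟ _) (next-≢-next² m))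
        where
        r : role x ≡ outer m false
        r = role-outer x∉ (nonadjacent⇒missed x∉ nonadjacent) refl

    -- With a, b, c = element 0F, 1F, 2F and x₁, y₁ the designated outer vertices missing b and a,
    -- colour true is the cycle a → b → y₁ → c → x₁ → a, every other outer vertex missing b being
    -- attached as a → x → c and every other one missing a as c → y → b.
    one-way : Role → Role → Bool
    one-way (core 0F)        (core 1F)        = true
    one-way (core 2F)        (outer 1F true)  = true
    one-way (outer 1F true)  (core 0F)        = true
    one-way (core 1F)        (outer 0F true)  = true
    one-way (outer 0F true)  (core 2F)        = true
    one-way (core 0F)        (outer 1F false) = true
    one-way (outer 1F false) (core 2F)        = true
    one-way (core 2F)        (outer 0F false) = true
    one-way (outer 0F false) (core 1F)        = true
    one-way _                _                = false

    one-way-exit : ∀ k m d → m ≢ 2F → Exit one-way k m d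
    one-way-exit true  0F true  _ = 2F , (λ ()) , refl
    one-way-exit true  0F false _ = 1F , (λ ()) , refl
    one-way-exit true  1F true  _ = 0F , (λ ()) , refl
    one-way-exit true  1F false _ = 2F , (λ ()) , refl
    one-way-exit false 0F true  _ = 1F , (λ ()) , refl
    one-way-exit false 0F false _ = 2F , (λ ()) , refl
    one-way-exit false 1F true  _ = 2F , (λ ()) , refl
    one-way-exit false 1F false _ = 0F , (λ ()) , refl
    one-way-exit _     2F _     ≢2 = ⊥-elim (≢2 refl)

    one-way-entry : ∀ k m d → m ≢ 2F → Entry one-way k m d
    one-way-entry true  0F true  _ = 1F , (λ ()) , refl
    one-way-entry true  0F false _ = 2F , (λ ()) , refl
    one-way-entry true  1F true  _ = 2F , (λ ()) , refl
    one-way-entry true  1F false _ = 0F , (λ ()) , refl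
    one-way-entry false 0F true  _ = 2F , (λ ()) , refl
    one-way-entry false 0F false _ = 1F , (λ ()) , refl
    one-way-entry false 1F true  _ = 0F , (λ ()) , refl
    one-way-entry false 1F false _ = 2F , (λ ()) , refl
    one-way-entry _     2F _     ≢2 = ⊥-elim (≢2 refl)

    module OneWay (adjacent-to-c : ∀ {x} → x ∉ V₂ → adjacentᵇ A x (element 2F) ≡ true)
                  (a→b : Arc A (element 0F) (element 1F)) (b↛a : A (element 1F) (element 0F) ≡ false) where

      missed-≢2 : ∀ {x} → x ∉ V₂ → missed x ≢ 2F
      missed-≢2 {x} x∉ m≡2 = true≢false (trans (sym (adjacent-to-c x∉))
        (subst (λ m → adjacentᵇ A x (element m) ≡ false) m≡2 (missed-nonadjacent x∉)))

      missed-if-adjacent-to-a : ∀ {x} → x ∉ V₂ → Adjacent A x (element 0F) → missed x ≡ 1F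
      missed-if-adjacent-to-a {x} x∉ adj with missed x | adjacent-not-missed x∉ adj | missed-≢2 x∉
      ... | 0F | ≢0 | _  = ⊥-elim (≢0 refl)
      ... | 1F | _  | _  = refl
      ... | 2F | _  | ≢2 = ⊥-elim (≢2 refl)

      missed-if-adjacent-to-b : ∀ {x} → x ∉ V₂ → Adjacent A x (element 1F) → missed x ≡ 0F
      missed-if-adjacent-to-b {x} x∉ adj with missed x | adjacent-not-missed x∉ adj | missed-≢2 x∉
      ... | 0F | _  | _  = refl
      ... | 1F | ≢1 | _  = ⊥-elim (≢1 refl)
      ... | 2F | _  | ≢2 = ⊥-elim (≢2 refl)

      in-neighbour-of-a : ∀ {w} → element 0F ≢ w →
        ∃ λ u → Arc A u (element 0F) × u ≢ w × (u ≡ element 2F ⊎ (u ∉ V₂ × missed u ≡ 1F))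
      in-neighbour-of-a a≢w with u , u→a , u≢w ← in-neighbour-avoiding two-arc-strong a≢w =
        u , u→a , u≢w , classify
        where
        classify : u ≡ element 2F ⊎ (u ∉ V₂ × missed u ≡ 1F)
        classify with u ∈? V₂
        ... | no  u∉ = inj₂ (u∉ , missed-if-adjacent-to-a u∉ (inj₁ u→a))
        ... | yes u∈ with element-surjective u∈
        ...   | 0F , refl = ⊥-elim (loopless-≢ {A = A} loopless u→a refl)
        ...   | 1F , refl = ⊥-elim (true≢false (trans (sym u→a) b↛a))
        ...   | 2F , refl = inj₁ refl

      out-neighbour-of-b : ∀ {w} → element 1F ≢ w →
        ∃ λ v → Arc A (element 1F) v × v ≢ w × (v ≡ element 2F ⊎ (v ∉ V₂ × missed v ≡ 0F))
      out-neighbour-of-b b≢w with v , b→v , v≢w ← out-neighbour-avoiding two-arc-strong b≢w =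
        v , b→v , v≢w , classify
        where
        classify : v ≡ element 2F ⊎ (v ∉ V₂ × missed v ≡ 0F)
        classify with v ∈? V₂
        ... | no  v∉ = inj₂ (v∉ , missed-if-adjacent-to-b v∉ (inj₂ b→v))
        ... | yes v∈ with element-surjective v∈
        ...   | 0F , refl = ⊥-elim (true≢false (trans (sym b→v) b↛a))
        ...   | 1F , refl = ⊥-elim (loopless-≢ {A = A} loopless b→v refl)
        ...   | 2F , refl = inj₁ refl

      module Designated {x₁ y₁ : Fin n}
        (x₁∉ : x₁ ∉ V₂) (x₁-missed : missed x₁ ≡ 1F)
        (y₁∉ : y₁ ∉ V₂) (y₁-missed : missed y₁ ≡ 0F) where

        designated : Fin n → Bool
        designated u = does (u ≟ x₁) ∨ does (u ≟ y₁)

        open Colouring designated one-way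

        x₁-role : role x₁ ≡ outer 1F true
        x₁-role = role-outer x₁∉ x₁-missed (cong (_∨ does (x₁ ≟ y₁)) (≟-diag x₁))

        y₁-role : role y₁ ≡ outer 0F true
        y₁-role = role-outer y₁∉ y₁-missed (trans (cong (does (y₁ ≟ x₁) ∨_) (≟-diag y₁)) (∨-zeroʳ _))

        undesignated : ∀ {x} → x ≢ x₁ → x ≢ y₁ → designated x ≡ false
        undesignated x≢x₁ x≢y₁ = cong₂ _∨_ (dec-false (_ ≟ _) x≢x₁) (dec-false (_ ≟ _) x≢y₁)

        c⇝a₂ : Star (Class false) (element 2F) (element 0F)
        c⇝a₂ with u , u→a , u≢x₁ , u-kind ← in-neighbour-of-a (λ { refl → x₁∉ (element-∈ 0F) }) with u-kind
        ... | inj₁ refl = core-arc u→a refl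
        ... | inj₂ (u∉ , u-missed) = detour u-role (λ ()) (λ ()) refl refl
          where
          u-role : role u ≡ outer 1F false
          u-role = role-outer u∉ u-missed
            (undesignated u≢x₁ λ { refl → case trans (sym u-missed) y₁-missed of λ () })

        b⇝c₂ : Star (Class false) (element 1F) (element 2F)
        b⇝c₂ with v , b→v , v≢y₁ , v-kind ← out-neighbour-of-b (λ { refl → y₁∉ (element-∈ 1F) }) with v-kind
        ... | inj₁ refl = core-arc b→v refl
        ... | inj₂ (v∉ , v-missed) = detour v-role (λ ()) (λ ()) refl refl
          where
          v-role : role v ≡ outer 0F false
          v-role = role-outer v∉ v-missed
            (undesignated (λ { refl → case trans (sym v-missed) x₁-missed of λ () }) v≢y₁)

        decomposition : HasStrongArcDecomposition A
        decomposition =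
          colour ,
          class-strong
            (cycle-connects {0F} {1F} {2F} (λ ()) (λ ()) (λ ()) element
              (core-arc a→b refl) (detour y₁-role (λ ()) (λ ()) refl refl) (detour x₁-role (λ ()) (λ ()) refl refl))
            (exit true) (entry true) ,
          class-strong
            (cycle-connects {0F} {2F} {1F} (λ ()) (λ ()) (λ ()) element
              (detour x₁-role (λ ()) (λ ()) refl refl) (detour y₁-role (λ ()) (λ ()) refl refl) (b⇝c₂ ◅◅ c⇝a₂))
            (exit false) (entry false)
          where
          exit : ∀ k {x} → x ∉ V₂ → Exit one-way k (missed x) (designated x)
          exit k {x} x∉ = one-way-exit k (missed x) (designated x) (missed-≢2 x∉)
          entry : ∀ k {x} → x ∉ V₂ → Entry one-way k (missed x) (designated x)
          entry k {x} x∉ = one-way-entry k (missed x) (designated x) (missed-≢2 x∉)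

      one-way-decomposition : HasStrongArcDecomposition A
      one-way-decomposition
        with _ , _ , x₁≢c , x₁-kind ← in-neighbour-of-a (element-≢ λ ())
           | _ , _ , y₁≢c , y₁-kind ← out-neighbour-of-b (element-≢ λ ())
        with x₁-kind | y₁-kind
      ... | inj₁ x₁≡c | _ = ⊥-elim (x₁≢c x₁≡c)
      ... | inj₂ _ | inj₁ y₁≡c = ⊥-elim (y₁≢c y₁≡c)
      ... | inj₂ (x₁∉ , x₁-missed) | inj₂ (y₁∉ , y₁-missed) =
        Designated.decomposition x₁∉ x₁-missed y₁∉ y₁-missed

  module _ (e : Enumeration V₂ 3) where
    open Enumeration e
    open Decomposition

    reordered : (p q r : Fin 3) → p ≢ q → q ≢ r → p ≢ r → Enumeration V₂ 3
    reordered p q r p≢q q≢r p≢r =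
      reindex e (triple p q r) (triple-injective p≢q q≢r p≢r) (triple-surjective p≢q q≢r p≢r)

    two-cycle-or-decomposition : ∀ m → (∀ {x} → x ∉ V₂ → adjacentᵇ A x (element m) ≡ true) →
      TwoCycle A (element (next m)) (element (next (next m))) ⊎ HasStrongArcDecomposition A
    two-cycle-or-decomposition m adjacent-to-m
      with A (element (next m)) (element (next (next m))) in p→q
         | A (element (next (next m))) (element (next m)) in q→p
    ... | true  | true  = inj₁ (refl , refl)
    ... | true  | false = inj₂ (OneWay.one-way-decomposition
          (reordered (next m) (next (next m)) m (next-≢-next² m) (next²-≢ m) (next-≢ m))
          adjacent-to-m p→q q→p)
    ... | false | true  = inj₂ (OneWay.one-way-decomposition
          (reordered (next (next m)) (next m) m (next-≢ (next m)) (next-≢ m) (next²-≢ m))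
          adjacent-to-m q→p p→q)
    ... | false | false
      with semicomplete _ _ (element-∈ (next m)) (element-∈ (next (next m))) (element-≢ e (next-≢-next² m))
    ...   | inj₁ p→q′ = ⊥-elim (true≢false (trans (sym p→q′) p→q))
    ...   | inj₂ q→p′ = ⊥-elim (true≢false (trans (sym q→p′) q→p))

    gap-or-decomposition : ∀ m → Gap e m ⊎ HasStrongArcDecomposition A
    gap-or-decomposition m with any? (λ x → ¬? (x ∈? V₂) ×-dec (adjacentᵇ A x (element m) ≟ᵇ false))
    ... | yes outer-nonadjacent = inj₁ (inj₂ outer-nonadjacent)
    ... | no none = map₁ inj₁
          (two-cycle-or-decomposition m λ x∉ → ¬-not λ nonadjacent → none (_ , x∉ , nonadjacent))

    decomposition : HasStrongArcDecomposition A
    decomposition = [ cyclic-decomposition e , id ]′ (all-or gap-or-decomposition)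

corollaryA1 : (n : ℕ) (A : Digraph n) (V₂ : Subset n) →
    Loopless A → TwoArcStrong A → IndependentV1 A V₂ → SemicompleteV2 A V₂ →
    MaximalPartition A V₂ → ∣ V₂ ∣ ≡ 3 → HasStrongArcDecomposition A
corollaryA1 n A V₂ loopless two-arc-strong independent semicomplete maximal |V₂|≡3 =
  SplitDigraph.decomposition loopless two-arc-strong independent semicomplete maximal
    (subst (Enumeration V₂) |V₂|≡3 (enumerate V₂))
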